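{- Let $\ell\ge1$, $0\le k\le\ell$, let $B=(b_1,\ldots,b_\ell)$ with integers $b_i\ge2$, and let $v'\in\Gamma_B$. Then (i) for every $u\in\Sigma_B$, $\displaystyle\sum_{y\in M_{\ell,k;B}(u)}\nu_B(y,v')=(-1)^{\ell-k}S_{\ell-k}(B(G_{v'}))\,\nu_B(u,v')$; (ii) for every $v\in V_{\ell,k;B}$, $\displaystyle\sum_{u\in N_{\ell,k;B}(v)}\nu_B(u,v')=(-1)^{\ell-k}\nu_B(v,v')$.
   Context: For an integer $b\ge2$ let $\Sigma_b=\{0,\ldots,b-1\}$, $\Delta_b=\Sigma_b\cup\{g\}$ with $g$ a gap symbol, $\Gamma_b=\Delta_b\setminus\{0\}$; $\Sigma_B,\Delta_B,\Gamma_B$ are the products over $b_1,\ldots,b_\ell$, elements written as words $v_1\cdots v_\ell$. For $v\in\Delta_B$, $G_v=\{i: v_i=g\}$, $\overline G_v=[\ell]\setminus G_v$. $V_{\ell,k;B}=\{v\in\Delta_B:|G_v|=\ell-k\}$. $u\in\Sigma_B$ and $v\in\Delta_B$ match ($v\sim u$) if $u_i=v_i$ for every $i$ with $v_i\ne g$. $M_{\ell,k;B}(u)=\{v\in V_{\ell,k;B}: v\sim u\}$ and $N_{\ell,k;B}(v)=\{u\in\Sigma_B: v\sim u\}$. For $X=\{x_1<\cdots<x_n\}\subseteq[\ell]$, $B(X)=(b_{x_1},\ldots,b_{x_n})$; $S_i$ is the $i$-th elementary symmetric polynomial ($S_0=1$, $S_i=0$ if $i$ exceeds the number of variables). On $\Delta_{b_i}$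 use the order $0\prec1\prec\cdots\prec b_i-1\prec g$, and set $\nu_i(x,y)=-b_i$ if $x=y=g$; $-y$ if $x=y\ne g$; $1$ if $x\prec y$; $0$ if $y\prec x$; and $\nu_B(x,y)=\prod_{i=1}^\ell\nu_i(x_i,y_i)$ for $x,y\in\Delta_B$. -}

module Defs where

open import Data.Nat using (ℕ; zero; suc; _∸_)
import Data.Nat as ℕ
open import Data.Fin using (Fin; toℕ)
import Data.Fin as Fin
open import Data.Fin.Properties using () renaming (_≟_ to _≟ᶠ_)
open import Data.Integer using (ℤ; +_; -_; _+_; _*_; 0ℤ; 1ℤ)
open import Data.List using (List; []; _∷_; _++_; map; concatMap; filter; allFin; foldr)
open import Data.Vec using (Vec; []; _∷_)
open import Data.Product using (_×_; _,_)
open import Data.Unit using (⊤; tt)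
open import Data.Empty using (⊥)
open import Relation.Binary.PropositionalEquality using (_≡_; _≢_; refl)
open import Relation.Nullary using (Dec; yes; no; ¬_)
open import Relation.Nullary.Decidable using (_×-dec_)
open import Relation.Unary using (Decidable)

data Sym (b : ℕ) : Set where
  sym : Fin b → Sym b
  gap : Sym b

data Word (F : ℕ → Set) : {n : ℕ} → Vec ℕ n → Set where
  []  : Word F []
  _∷_ : {n b : ℕ} {B : Vec ℕ n} → F b → Word F B → Word F (b ∷ B)

ΣB : {n : ℕ} → Vec ℕ n → Set
ΣB B = Word Fin B

ΔB : {n : ℕ} → Vec ℕ n → Set
ΔB B = Word Sym B

-- Enumeration of all letters / all words (each element exactly once).
allSym : (b : ℕ) → List (Sym b)
allSym b = map sym (allFin b) ++ (gap ∷ [])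

allWords : {F : ℕ → Set} → ((b : ℕ) → List (F b)) → {n : ℕ} → (B : Vec ℕ n) → List (Word F B)
allWords enum []      = [] ∷ []
allWords enum (b ∷ B) = concatMap (λ x → map (x ∷_) (allWords enum B)) (enum b)

allΣ : {n : ℕ} → (B : Vec ℕ n) → List (ΣB B)
allΣ = allWords allFin

allΔ : {n : ℕ} → (B : Vec ℕ n) → List (ΔB B)
allΔ = allWords allSym

NonZeroSym : {b : ℕ} → Sym b → Set
NonZeroSym (sym x) = toℕ x ≢ 0
NonZeroSym gap     = ⊤

data InΓ : {n : ℕ} {B : Vec ℕ n} → ΔB B → Set where
  []  : InΓ []
  _∷_ : {n b : ℕ} {B : Vec ℕ n} {x : Sym b} {v : ΔB B} → NonZeroSym x → InΓ v → InΓ (x ∷ v)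

gapCount : {n : ℕ} {B : Vec ℕ n} → ΔB B → ℕ
gapCount []          = 0
gapCount (sym _ ∷ v) = gapCount v
gapCount (gap   ∷ v) = suc (gapCount v)

BG : {n : ℕ} {B : Vec ℕ n} → ΔB B → List ℕ
BG []                 = []
BG (sym _ ∷ v)        = BG v
BG {B = b ∷ _} (gap ∷ v) = b ∷ BG v

LetterMatch : {b : ℕ} → Sym b → Fin b → Set
LetterMatch (sym x) y = x ≡ y
LetterMatch gap     y = ⊤

data _∼_ : {n : ℕ} {B : Vec ℕ n} → ΔB B → ΣB B → Set where
  []  : [] ∼ []
  _∷_ : {n b : ℕ} {B : Vec ℕ n} {x : Sym b} {y : Fin b} {v : ΔB B} {u : ΣB B} →
        LetterMatch x y → v ∼ u → (x ∷ v) ∼ (y ∷ u)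

letterMatch? : {b : ℕ} (x : Sym b) (y : Fin b) → Dec (LetterMatch x y)
letterMatch? (sym x) y = x ≟ᶠ y
letterMatch? gap     y = yes tt

match? : {n : ℕ} {B : Vec ℕ n} (v : ΔB B) (u : ΣB B) → Dec (v ∼ u)
match? [] [] = yes []
match? (x ∷ v) (y ∷ u) with letterMatch? x y | match? v u
... | yes p | yes q = yes (p ∷ q)
... | no ¬p | _     = no λ { (p ∷ _) → ¬p p }
... | yes _ | no ¬q = no λ { (_ ∷ q) → ¬q q }

InV : (ℓ k : ℕ) {B : Vec ℕ ℓ} → ΔB B → Set
InV ℓ k v = gapCount v ≡ ℓ ∸ k

M : (ℓ k : ℕ) (B : Vec ℕ ℓ) → ΣB B → List (ΔB B)
M ℓ k B u = filter (λ v → (gapCount v ℕ.≟ ℓ ∸ k) ×-dec match? v u) (allΔ B)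

N : (ℓ k : ℕ) (B : Vec ℕ ℓ) → ΔB B → List (ΣB B)
N ℓ k B v = filter (λ u → match? v u) (allΣ B)

embed : {n : ℕ} {B : Vec ℕ n} → ΣB B → ΔB B
embed []      = []
embed (x ∷ u) = sym x ∷ embed u

-- ν_i on Δ_{b} with order 0 ≺ 1 ≺ … ≺ b-1 ≺ g
νletter : {b : ℕ} → Sym b → Sym b → ℤ
νletter {b} gap     gap     = - (+ b)
νletter     (sym x) gap     = 1ℤ
νletter     gap     (sym y) = 0ℤ
νletter     (sym x) (sym y) with x ≟ᶠ y | toℕ x ℕ.<? toℕ y
... | yes _ | _     = - (+ toℕ y)
... | no _  | yes _ = 1ℤ
... | no _  | no _  = 0ℤ

νB : {n : ℕ} {B : Vec ℕ n} → ΔB B → ΔB B → ℤ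
νB []      []      = 1ℤ
νB (x ∷ v) (y ∷ w) = νletter x y * νB v w

esym : ℕ → List ℕ → ℤ
esym zero    _        = 1ℤ
esym (suc i) []       = 0ℤ
esym (suc i) (x ∷ xs) = (+ x) * esym i xs + esym (suc i) xs

sumℤ : List ℤ → ℤ
sumℤ = foldr _+_ 0ℤ

{-# OPTIONS --safe #-}
module Submission where

-- ν_B is a product of letterwise factors and matching is a letterwise condition, so both
-- sums factor over the positions. In (ii) a fixed digit a of v contributes ν(a, z), and a
-- gap contributes the column sum Σ_c ν(c, z) = -ν(g, z), i.e. -b for z = g and -d + d = 0
-- for z = d. In (i) each position of y either copies uᵢ or is a gap; a gap gives ν(g, z),
-- which is 0 unless z = g, and then -bᵢ against ν(uᵢ, g) = 1. Hence the sum is ν(u, v′)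
-- times the coefficient of t^(ℓ-k) in ∏_{i ∈ G_v′} (1 - bᵢ t).

open import Defs
open import Data.Bool using (Bool; true; false; _∧_; if_then_else_)
open import Data.Bool.Properties using (∧-commutativeMonoid)
open import Algebra.Bundles using (CommutativeMonoid)
open import Algebra.Properties.CommutativeSemigroup (CommutativeMonoid.commutativeSemigroup ∧-commutativeMonoid)
  using (x∙yz≈y∙xz)
open import Data.Fin using (Fin; toℕ; zero; suc)
open import Data.Fin.Properties using () renaming (_≟_ to _≟ᶠ_)
open import Data.Integer using (ℤ; +_; -_; _+_; _*_; _^_; 0ℤ; 1ℤ)
open import Data.Integer.Properties
  using (+-identityˡ; +-identityʳ; +-assoc; +-inverseˡ; *-zeroˡ; *-zeroʳ; *-distribˡ-+; *-comm; neg-involutive)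
open import Data.Integer.Tactic.RingSolver using (solve-∀)
open import Data.List using (List; []; _∷_; _++_; map; concatMap; filter; allFin)
open import Data.List.Properties using (map-tabulate)
open import Data.Nat using (ℕ; _≤_; _∸_)
import Data.Nat as ℕ
open import Data.Nat.Properties using (n≮n)
open import Data.Empty using (⊥-elim)
open import Data.Product using (_×_; _,_)
open import Data.Vec using (Vec; []; _∷_)
open import Data.Vec.Relation.Unary.All using (All)
open import Function using (_∘_; id)
open import Relation.Binary.PropositionalEquality using (_≡_; refl; trans; cong; cong₂; module ≡-Reasoning)
  renaming (sym to ≡-sym)
open import Relation.Nullary using (Dec; does; yes; no)
open import Relation.Nullary.Decidable using (dec-true; dec-false)

open ≡-Reasoning

∑ : {A : Set} → List A → (A → ℤ) → ℤ
∑ xs f = sumℤ (map f xs)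

infix 8 [_]·_
[_]·_ : Bool → ℤ → ℤ
[ p ]· x = if p then x else 0ℤ

[]·-* : (p : Bool) (a x : ℤ) → [ p ]· (a * x) ≡ a * [ p ]· x
[]·-* true  a x = refl
[]·-* false a x = ≡-sym (*-zeroʳ a)

∑-cong : {A : Set} (xs : List A) {f g : A → ℤ} → (∀ x → f x ≡ g x) → ∑ xs f ≡ ∑ xs g
∑-cong []       f≗g = refl
∑-cong (x ∷ xs) f≗g = cong₂ _+_ (f≗g x) (∑-cong xs f≗g)

∑-zero : {A : Set} (xs : List A) → ∑ xs (λ _ → 0ℤ) ≡ 0ℤ
∑-zero []       = refl
∑-zero (x ∷ xs) = trans (+-identityˡ _) (∑-zero xs)

∑-++ : {A : Set} (xs ys : List A) (f : A → ℤ) → ∑ (xs ++ ys) f ≡ ∑ xs f + ∑ ys f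
∑-++ []       ys f = ≡-sym (+-identityˡ _)
∑-++ (x ∷ xs) ys f = trans (cong (_+_ (f x)) (∑-++ xs ys f)) (≡-sym (+-assoc (f x) _ _))

∑-map : {A C : Set} (xs : List A) (h : A → C) (f : C → ℤ) → ∑ (map h xs) f ≡ ∑ xs (f ∘ h)
∑-map []       h f = refl
∑-map (x ∷ xs) h f = cong (_+_ (f (h x))) (∑-map xs h f)

∑-concatMap : {A C : Set} (xs : List A) (g : A → List C) (f : C → ℤ) →
  ∑ (concatMap g xs) f ≡ ∑ xs (λ x → ∑ (g x) f)
∑-concatMap []       g f = refl
∑-concatMap (x ∷ xs) g f = trans (∑-++ (g x) _ f) (cong (_+_ (∑ (g x) f)) (∑-concatMap xs g f))

∑-filter : {A : Set} {P : A → Set} (P? : (x : A) → Dec (P x)) (xs : List A) (f : A → ℤ) →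
  ∑ (filter P? xs) f ≡ ∑ xs (λ x → [ does (P? x) ]· f x)
∑-filter P? []       f = refl
∑-filter P? (x ∷ xs) f with does (P? x)
... | true  = cong (_+_ (f x)) (∑-filter P? xs f)
... | false = trans (∑-filter P? xs f) (≡-sym (+-identityˡ _))

∑-*ˡ : {A : Set} (xs : List A) (a : ℤ) (f : A → ℤ) → ∑ xs (λ x → a * f x) ≡ a * ∑ xs f
∑-*ˡ []       a f = ≡-sym (*-zeroʳ a)
∑-*ˡ (x ∷ xs) a f = trans (cong (_+_ (a * f x)) (∑-*ˡ xs a f)) (≡-sym (*-distribˡ-+ a (f x) _))

∑-*ʳ : {A : Set} (xs : List A) (a : ℤ) (f : A → ℤ) → ∑ xs (λ x → f x * a) ≡ ∑ xs f * a
∑-*ʳ xs a f = begin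
  ∑ xs (λ x → f x * a)  ≡⟨ ∑-cong xs (λ x → *-comm (f x) a) ⟩
  ∑ xs (λ x → a * f x)  ≡⟨ ∑-*ˡ xs a f ⟩
  a * ∑ xs f            ≡⟨ *-comm a _ ⟩
  ∑ xs f * a            ∎

∑-+ : {A : Set} (xs : List A) (f g : A → ℤ) → ∑ xs (λ x → f x + g x) ≡ ∑ xs f + ∑ xs g
∑-+ []       f g = refl
∑-+ (x ∷ xs) f g = trans (cong (_+_ (f x + g x)) (∑-+ xs f g)) (interchange (f x) (g x) (∑ xs f) (∑ xs g))
  where
  interchange : ∀ a b c d → a + b + (c + d) ≡ a + c + (b + d)
  interchange = solve-∀

∑-[∧]·-* : {A : Set} (xs : List A) (p : Bool) (q : A → Bool) (a : ℤ) (g : A → ℤ) →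
  ∑ xs (λ x → [ p ∧ q x ]· (a * g x)) ≡ [ p ]· a * ∑ xs (λ x → [ q x ]· g x)
∑-[∧]·-* xs true  q a g = trans (∑-cong xs (λ x → []·-* (q x) a (g x))) (∑-*ˡ xs a (λ x → [ q x ]· g x))
∑-[∧]·-* xs false q a g = trans (∑-zero xs) (≡-sym (*-zeroˡ (∑ xs (λ x → [ q x ]· g x))))

∑-allWords-∷ : {F : ℕ → Set} (e : (b : ℕ) → List (F b)) {n b : ℕ} (B : Vec ℕ n) (f : Word F (b ∷ B) → ℤ) →
  ∑ (allWords e (b ∷ B)) f ≡ ∑ (e b) (λ x → ∑ (allWords e B) (λ w → f (x ∷ w)))
∑-allWords-∷ e {b = b} B f =
  trans (∑-concatMap (e b) (λ x → map (x ∷_) (allWords e B)) f) (∑-cong (e b) (λ x → ∑-map (allWords e B) (x ∷_) f))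

∑-allFin-suc : (b : ℕ) (f : Fin (ℕ.suc b) → ℤ) → ∑ (allFin (ℕ.suc b)) f ≡ f zero + ∑ (allFin b) (f ∘ suc)
∑-allFin-suc b f = cong (_+_ (f zero))
  (trans (cong (λ cs → ∑ cs f) (≡-sym (map-tabulate id suc))) (∑-map (allFin b) suc f))

∑-δ : (b : ℕ) (a : Fin b) (g : Fin b → ℤ) → ∑ (allFin b) (λ c → [ does (c ≟ᶠ a) ]· g c) ≡ g a
∑-δ (ℕ.suc b) zero    g = begin
  ∑ (allFin (ℕ.suc b)) δg          ≡⟨ ∑-allFin-suc b δg ⟩
  g zero + ∑ (allFin b) (δg ∘ suc)  ≡⟨ cong (_+_ (g zero)) (∑-zero (allFin b)) ⟩
  g zero + 0ℤ                       ≡⟨ +-identityʳ _ ⟩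
  g zero                            ∎
  where δg = λ c → [ does (c ≟ᶠ zero) ]· g c
∑-δ (ℕ.suc b) (suc a) g = trans (∑-allFin-suc b (λ c → [ does (c ≟ᶠ suc a) ]· g c))
  (trans (+-identityˡ _) (∑-δ b a (g ∘ suc)))

does-≟ᶠ-comm : {b : ℕ} (a c : Fin b) → does (a ≟ᶠ c) ≡ does (c ≟ᶠ a)
does-≟ᶠ-comm a c with a ≟ᶠ c
... | yes refl = ≡-sym (dec-true (a ≟ᶠ a) refl)
... | no  a≢c  = ≡-sym (dec-false (c ≟ᶠ a) (a≢c ∘ ≡-sym))

∑-count-< : (b : ℕ) (d : Fin b) → ∑ (allFin b) (λ c → [ does (toℕ c ℕ.<? toℕ d) ]· 1ℤ) ≡ + toℕ d
∑-count-< (ℕ.suc b) zero    =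
  trans (∑-allFin-suc b (λ c → [ does (toℕ c ℕ.<? 0) ]· 1ℤ)) (trans (+-identityˡ _) (∑-zero (allFin b)))
∑-count-< (ℕ.suc b) (suc d) =
  trans (∑-allFin-suc b (λ c → [ does (toℕ c ℕ.<? toℕ (suc d)) ]· 1ℤ)) (cong (_+_ 1ℤ) (∑-count-< b d))

∑-one : (b : ℕ) → ∑ (allFin b) (λ _ → 1ℤ) ≡ + b
∑-one ℕ.zero    = refl
∑-one (ℕ.suc b) = trans (∑-allFin-suc b (λ _ → 1ℤ)) (cong (_+_ 1ℤ) (∑-one b))

νletter-sym-sym : {b : ℕ} (c d : Fin b) →
  νletter (sym c) (sym d) ≡ [ does (c ≟ᶠ d) ]· - (+ toℕ d) + [ does (toℕ c ℕ.<? toℕ d) ]· 1ℤ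
νletter-sym-sym c d with c ≟ᶠ d | toℕ c ℕ.<? toℕ d
... | yes refl | yes c<c = ⊥-elim (n≮n _ c<c)
... | yes refl | no  c≮c = ≡-sym (trans (cong (λ t → - (+ toℕ c) + [ t ]· 1ℤ) (dec-false (toℕ c ℕ.<? toℕ c) c≮c))
                                        (+-identityʳ _))
... | no  _    | yes c<d = cong (λ t → 0ℤ + [ t ]· 1ℤ) (≡-sym (dec-true (toℕ c ℕ.<? toℕ d) c<d))
... | no  _    | no  c≮d = cong (λ t → 0ℤ + [ t ]· 1ℤ) (≡-sym (dec-false (toℕ c ℕ.<? toℕ d) c≮d))

∑-νletter-column : {b : ℕ} (z : Sym b) → ∑ (allFin b) (λ c → νletter (sym c) z) ≡ - νletter gap z
∑-νletter-column {b} gap     = trans (∑-one b) (≡-sym (neg-involutive (+ b)))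
∑-νletter-column {b} (sym d) = begin
  ∑ (allFin b) (λ c → νletter (sym c) (sym d))
    ≡⟨ ∑-cong (allFin b) (λ c → νletter-sym-sym c d) ⟩
  ∑ (allFin b) (λ c → equal c + less c)
    ≡⟨ ∑-+ (allFin b) equal less ⟩
  ∑ (allFin b) equal + ∑ (allFin b) less
    ≡⟨ cong₂ _+_ (∑-δ b d (λ _ → - (+ toℕ d))) (∑-count-< b d) ⟩
  - (+ toℕ d) + + toℕ d
    ≡⟨ +-inverseˡ (+ toℕ d) ⟩
  0ℤ ∎
  where
  equal less : Fin b → ℤ
  equal c = [ does (c ≟ᶠ d) ]· - (+ toℕ d)
  less  c = [ does (toℕ c ℕ.<? toℕ d) ]· 1ℤ

does-match?-∷ : {n b : ℕ} {B : Vec ℕ n} (x : Sym b) (v : ΔB B) (y : Fin b) (u : ΣB B) →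
  does (match? (x ∷ v) (y ∷ u)) ≡ does (letterMatch? x y) ∧ does (match? v u)
does-match?-∷ x v y u with letterMatch? x y | match? v u
... | yes _ | yes _ = refl
... | yes _ | no  _ = refl
... | no  _ | _     = refl

letterSum : {b : ℕ} → Sym b → Sym b → ℤ
letterSum {b} x z = ∑ (allFin b) (λ c → [ does (letterMatch? x c) ]· νletter (sym c) z)

letterSum-sym : {b : ℕ} (a : Fin b) (z : Sym b) → letterSum (sym a) z ≡ νletter (sym a) z
letterSum-sym {b} a z =
  trans (∑-cong (allFin b) (λ c → cong (λ t → [ t ]· νletter (sym c) z) (does-≟ᶠ-comm a c)))
        (∑-δ b a (λ c → νletter (sym c) z))

matchSum : {n : ℕ} {B : Vec ℕ n} → ΔB B → ΔB B → ℤ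
matchSum {B = B} v w = ∑ (allΣ B) (λ u → [ does (match? v u) ]· νB (embed u) w)

matchSum-∷ : {n b : ℕ} {B : Vec ℕ n} (x : Sym b) (v : ΔB B) (z : Sym b) (w : ΔB B) →
  matchSum (x ∷ v) (z ∷ w) ≡ letterSum x z * matchSum v w
matchSum-∷ {b = b} {B} x v z w = begin
  matchSum (x ∷ v) (z ∷ w)
    ≡⟨ ∑-allWords-∷ allFin B (λ u → [ does (match? (x ∷ v) u) ]· νB (embed u) (z ∷ w)) ⟩
  ∑ (allFin b) (λ c → ∑ (allΣ B) (λ u → [ does (match? (x ∷ v) (c ∷ u)) ]· (νletter (sym c) z * νB (embed u) w)))
    ≡⟨ ∑-cong (allFin b) separate ⟩
  ∑ (allFin b) (λ c → [ does (letterMatch? x c) ]· νletter (sym c) z * matchSum v w)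
    ≡⟨ ∑-*ʳ (allFin b) (matchSum v w) (λ c → [ does (letterMatch? x c) ]· νletter (sym c) z) ⟩
  letterSum x z * matchSum v w ∎
  where
  separate : (c : Fin b) →
    ∑ (allΣ B) (λ u → [ does (match? (x ∷ v) (c ∷ u)) ]· (νletter (sym c) z * νB (embed u) w))
      ≡ [ does (letterMatch? x c) ]· νletter (sym c) z * matchSum v w
  separate c = trans
    (∑-cong (allΣ B) (λ u → cong (λ t → [ t ]· (νletter (sym c) z * νB (embed u) w)) (does-match?-∷ x v c u)))
    (∑-[∧]·-* (allΣ B) (does (letterMatch? x c)) (λ u → does (match? v u)) (νletter (sym c) z) (λ u → νB (embed u) w))

matchSum-νB : {n : ℕ} {B : Vec ℕ n} (v w : ΔB B) → matchSum v w ≡ (- 1ℤ) ^ gapCount v * νB v w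
matchSum-νB []      []      = refl
matchSum-νB (x ∷ v) (z ∷ w) = begin
  matchSum (x ∷ v) (z ∷ w)                            ≡⟨ matchSum-∷ x v z w ⟩
  letterSum x z * matchSum v w                        ≡⟨ cong (letterSum x z *_) (matchSum-νB v w) ⟩
  letterSum x z * ((- 1ℤ) ^ gapCount v * νB v w)      ≡⟨ signed x ⟩
  (- 1ℤ) ^ gapCount (x ∷ v) * νB (x ∷ v) (z ∷ w)      ∎
  where
  signed : (x : Sym _) →
    letterSum x z * ((- 1ℤ) ^ gapCount v * νB v w) ≡ (- 1ℤ) ^ gapCount (x ∷ v) * (νletter x z * νB v w)
  signed (sym a) = trans (cong (_* _) (letterSum-sym a z)) (swap (νletter (sym a) z) ((- 1ℤ) ^ gapCount v) (νB v w))
    where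
    swap : ∀ p q r → p * (q * r) ≡ q * (p * r)
    swap = solve-∀
  signed gap = trans (cong (_* _) (∑-νletter-column z)) (swap (νletter gap z) ((- 1ℤ) ^ gapCount v) (νB v w))
    where
    swap : ∀ p q r → - p * (q * r) ≡ - 1ℤ * q * (p * r)
    swap = solve-∀

gapSum : ℕ → {n : ℕ} {B : Vec ℕ n} → ΣB B → ΔB B → ℤ
gapSum m {B = B} u w = ∑ (allΔ B) (λ y → [ does (gapCount y ℕ.≟ m) ∧ does (match? y u) ]· νB y w)

gapSum-∷ : (m : ℕ) {n b : ℕ} {B : Vec ℕ n} (a : Fin b) (u : ΣB B) (z : Sym b) (w : ΔB B) →
  gapSum m (a ∷ u) (z ∷ w)
    ≡ νletter (sym a) z * gapSum m u w
      + ∑ (allΔ B) (λ y → [ does (ℕ.suc (gapCount y) ℕ.≟ m) ∧ does (match? y u) ]· (νletter gap z * νB y w))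
gapSum-∷ m {b = b} {B} a u z w = begin
  gapSum m (a ∷ u) (z ∷ w)
    ≡⟨ ∑-allWords-∷ allSym B summand ⟩
  ∑ (map sym (allFin b) ++ gap ∷ []) (λ x → ∑ (allΔ B) (λ y → summand (x ∷ y)))
    ≡⟨ ∑-++ (map sym (allFin b)) (gap ∷ []) (λ x → ∑ (allΔ B) (λ y → summand (x ∷ y))) ⟩
  ∑ (map sym (allFin b)) (λ x → ∑ (allΔ B) (λ y → summand (x ∷ y))) + (gapPart + 0ℤ)
    ≡⟨ cong₂ _+_ digitPart (+-identityʳ gapPart) ⟩
  νletter (sym a) z * gapSum m u w + gapPart
    ≡⟨ cong (_+_ (νletter (sym a) z * gapSum m u w)) (∑-cong (allΔ B) (λ y →
         cong (λ t → [ does (ℕ.suc (gapCount y) ℕ.≟ m) ∧ t ]· (νletter gap z * νB y w)) (does-match?-∷ gap y a u))) ⟩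
  νletter (sym a) z * gapSum m u w
    + ∑ (allΔ B) (λ y → [ does (ℕ.suc (gapCount y) ℕ.≟ m) ∧ does (match? y u) ]· (νletter gap z * νB y w)) ∎
  where
  summand : ΔB (b ∷ B) → ℤ
  summand y = [ does (gapCount y ℕ.≟ m) ∧ does (match? y (a ∷ u)) ]· νB y (z ∷ w)

  gapPart : ℤ
  gapPart = ∑ (allΔ B) (λ y → summand (gap ∷ y))

  separate : (c : Fin b) →
    ∑ (allΔ B) (λ y → summand (sym c ∷ y)) ≡ [ does (c ≟ᶠ a) ]· νletter (sym c) z * gapSum m u w
  separate c = trans
    (∑-cong (allΔ B) (λ y → cong (λ t → [ t ]· (νletter (sym c) z * νB y w)) (begin
      does (gapCount y ℕ.≟ m) ∧ does (match? (sym c ∷ y) (a ∷ u))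
        ≡⟨ cong (does (gapCount y ℕ.≟ m) ∧_) (does-match?-∷ (sym c) y a u) ⟩
      does (gapCount y ℕ.≟ m) ∧ (does (c ≟ᶠ a) ∧ does (match? y u))
        ≡⟨ x∙yz≈y∙xz (does (gapCount y ℕ.≟ m)) (does (c ≟ᶠ a)) (does (match? y u)) ⟩
      does (c ≟ᶠ a) ∧ (does (gapCount y ℕ.≟ m) ∧ does (match? y u)) ∎)))
    (∑-[∧]·-* (allΔ B) (does (c ≟ᶠ a)) (λ y → does (gapCount y ℕ.≟ m) ∧ does (match? y u))
              (νletter (sym c) z) (λ y → νB y w))

  digitPart : ∑ (map sym (allFin b)) (λ x → ∑ (allΔ B) (λ y → summand (x ∷ y))) ≡ νletter (sym a) z * gapSum m u w
  digitPart = begin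
    ∑ (map sym (allFin b)) (λ x → ∑ (allΔ B) (λ y → summand (x ∷ y)))
      ≡⟨ ∑-map (allFin b) sym (λ x → ∑ (allΔ B) (λ y → summand (x ∷ y))) ⟩
    ∑ (allFin b) (λ c → ∑ (allΔ B) (λ y → summand (sym c ∷ y)))
      ≡⟨ ∑-cong (allFin b) separate ⟩
    ∑ (allFin b) (λ c → [ does (c ≟ᶠ a) ]· νletter (sym c) z * gapSum m u w)
      ≡⟨ ∑-*ʳ (allFin b) (gapSum m u w) (λ c → [ does (c ≟ᶠ a) ]· νletter (sym c) z) ⟩
    ∑ (allFin b) (λ c → [ does (c ≟ᶠ a) ]· νletter (sym c) z) * gapSum m u w
      ≡⟨ cong (_* gapSum m u w) (∑-δ b a (λ c → νletter (sym c) z)) ⟩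
    νletter (sym a) z * gapSum m u w ∎

gapSum-∷-zero : {n b : ℕ} {B : Vec ℕ n} (a : Fin b) (u : ΣB B) (z : Sym b) (w : ΔB B) →
  gapSum 0 (a ∷ u) (z ∷ w) ≡ νletter (sym a) z * gapSum 0 u w
gapSum-∷-zero {B = B} a u z w =
  trans (gapSum-∷ 0 a u z w)
    (trans (cong (_+_ (νletter (sym a) z * gapSum 0 u w)) (∑-zero (allΔ B))) (+-identityʳ _))

gapSum-∷-suc : (m : ℕ) {n b : ℕ} {B : Vec ℕ n} (a : Fin b) (u : ΣB B) (z : Sym b) (w : ΔB B) →
  gapSum (ℕ.suc m) (a ∷ u) (z ∷ w) ≡ νletter (sym a) z * gapSum (ℕ.suc m) u w + νletter gap z * gapSum m u w
gapSum-∷-suc m {B = B} a u z w = trans (gapSum-∷ (ℕ.suc m) a u z w)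
  (cong (_+_ (νletter (sym a) z * gapSum (ℕ.suc m) u w)) (∑-[∧]·-* (allΔ B) true (λ y → does (gapCount y ℕ.≟ m) ∧ does (match? y u)) (νletter gap z) (λ y → νB y w)))

gapSum-νB : (m : ℕ) {n : ℕ} {B : Vec ℕ n} (u : ΣB B) (w : ΔB B) →
  gapSum m u w ≡ (- 1ℤ) ^ m * esym m (BG w) * νB (embed u) w
gapSum-νB ℕ.zero    []      []      = refl
gapSum-νB (ℕ.suc m) []      []      = ≡-sym (cong (_* 1ℤ) (*-zeroʳ ((- 1ℤ) ^ ℕ.suc m)))
gapSum-νB ℕ.zero    (a ∷ u) (z ∷ w) = begin
  gapSum 0 (a ∷ u) (z ∷ w)                   ≡⟨ gapSum-∷-zero a u z w ⟩
  νletter (sym a) z * gapSum 0 u w            ≡⟨ cong (νletter (sym a) z *_) (gapSum-νB 0 u w) ⟩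
  νletter (sym a) z * (1ℤ * 1ℤ * νB (embed u) w) ≡⟨ regroup (νletter (sym a) z) (νB (embed u) w) ⟩
  1ℤ * 1ℤ * (νletter (sym a) z * νB (embed u) w) ∎
  where
  regroup : ∀ p r → p * (1ℤ * 1ℤ * r) ≡ 1ℤ * 1ℤ * (p * r)
  regroup = solve-∀
gapSum-νB (ℕ.suc m) (a ∷ u) (sym d ∷ w) = begin
  gapSum (ℕ.suc m) (a ∷ u) (sym d ∷ w)
    ≡⟨ gapSum-∷-suc m a u (sym d) w ⟩
  νletter (sym a) (sym d) * gapSum (ℕ.suc m) u w + 0ℤ * gapSum m u w
    ≡⟨ cong (λ t → νletter (sym a) (sym d) * t + 0ℤ * gapSum m u w) (gapSum-νB (ℕ.suc m) u w) ⟩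
  νletter (sym a) (sym d) * (σ * e * νB (embed u) w) + 0ℤ * gapSum m u w
    ≡⟨ regroup (νletter (sym a) (sym d)) σ e (νB (embed u) w) (gapSum m u w) ⟩
  σ * e * (νletter (sym a) (sym d) * νB (embed u) w) ∎
  where
  σ = (- 1ℤ) ^ ℕ.suc m
  e = esym (ℕ.suc m) (BG w)
  regroup : ∀ p s e r x → p * (s * e * r) + 0ℤ * x ≡ s * e * (p * r)
  regroup = solve-∀
gapSum-νB (ℕ.suc m) {B = b ∷ _} (a ∷ u) (gap ∷ w) = begin
  gapSum (ℕ.suc m) (a ∷ u) (gap ∷ w)
    ≡⟨ gapSum-∷-suc m a u gap w ⟩
  1ℤ * gapSum (ℕ.suc m) u w + - (+ b) * gapSum m u w
    ≡⟨ cong₂ (λ s t → 1ℤ * s + - (+ b) * t) (gapSum-νB (ℕ.suc m) u w) (gapSum-νB m u w) ⟩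
  1ℤ * (- 1ℤ * σ * e′ * ν) + - (+ b) * (σ * e * ν)
    ≡⟨ regroup σ e e′ ν (+ b) ⟩
  - 1ℤ * σ * (+ b * e + e′) * (1ℤ * ν) ∎
  where
  σ = (- 1ℤ) ^ m
  e = esym m (BG w)
  e′ = esym (ℕ.suc m) (BG w)
  ν = νB (embed u) w
  regroup : ∀ s e e′ r b → 1ℤ * (- 1ℤ * s * e′ * r) + - b * (s * e * r) ≡ - 1ℤ * s * (b * e + e′) * (1ℤ * r)
  regroup = solve-∀

proposition2 : (ℓ k : ℕ) → 1 ≤ ℓ → k ≤ ℓ → (B : Vec ℕ ℓ) → All (2 ≤_) B →
    (v′ : ΔB B) → InΓ v′ →
    ((u : ΣB B) →
      sumℤ (map (λ y → νB y v′) (M ℓ k B u))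
        ≡ ((- 1ℤ) ^ (ℓ ∸ k)) * esym (ℓ ∸ k) (BG v′) * νB (embed u) v′)
    × ((v : ΔB B) → InV ℓ k v →
      sumℤ (map (λ u → νB (embed u) v′) (N ℓ k B v))
        ≡ ((- 1ℤ) ^ (ℓ ∸ k)) * νB v v′)
proposition2 ℓ k _ _ B _ v′ _ = part-i , part-ii
  where
  part-i : (u : ΣB B) →
    ∑ (M ℓ k B u) (λ y → νB y v′) ≡ (- 1ℤ) ^ (ℓ ∸ k) * esym (ℓ ∸ k) (BG v′) * νB (embed u) v′
  part-i u = trans (∑-filter _ (allΔ B) (λ y → νB y v′)) (gapSum-νB (ℓ ∸ k) u v′)

  part-ii : (v : ΔB B) → InV ℓ k v → ∑ (N ℓ k B v) (λ u → νB (embed u) v′) ≡ (- 1ℤ) ^ (ℓ ∸ k) * νB v v′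
  part-ii v gaps = begin
    ∑ (N ℓ k B v) (λ u → νB (embed u) v′)  ≡⟨ ∑-filter (match? v) (allΣ B) (λ u → νB (embed u) v′) ⟩
    matchSum v v′                          ≡⟨ matchSum-νB v v′ ⟩
    (- 1ℤ) ^ gapCount v * νB v v′          ≡⟨ cong (λ g → (- 1ℤ) ^ g * νB v v′) gaps ⟩
    (- 1ℤ) ^ (ℓ ∸ k) * νB v v′             ∎
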